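{- Let $\mathcal L$ be a pre-reversible combined LTSI whose independence relation $\iota$ is non-empty and which satisfies IC (whenever $t\,\iota\,u$, the transitions $t$ and $u$ are coinitial). Then $\mathcal L$ does not satisfy IRE.
   Context: Setting. $\mathrm{Lab}$ is a set of labels and $\overline{\mathrm{Lab}}=\{\overline a: a\in\mathrm{Lab}\}$ a disjoint copy (reverse labels), with $\overline{\overline a}=a$. A combined LTSI $(\mathrm{Proc},\mathrm{Lab},\to,\iota)$ consists of a set $\mathrm{Proc}$ of processes, a set of forward transitions $(P,a,Q)$ with $a\in\mathrm{Lab}$, the set $\to$ of all transitions, consisting of the forward transitions together with, for each forward transition $(P,a,Q)$, the backward transition $(Q,\overline a,P)$, and an irreflexive symmetric relation $\iota$ on transitions. Write $t:P\xrightarrow{\alpha}Q$ for $t=(P,\alpha,Q)$ and $\overline t=(Q,\overline\alpha,P)$. Transitions are coinitial if they have the same source. Axioms. SP: whenever $t:P\xrightarrow{\alpha}Q$, $u:P\xrightarrow{\beta}R$, $t\,\iota\,u$, there are $u':Q\xrightarrow{\beta}S$, $t':R\xrightarrow{\alpha}S$. BTI: distinct backward transitions with the same source are independent. WF: no infinite sequence $P_0,P_1,\dots$ with forward transitions $P_{i+1}\xrightarrow{a_i}P_i$ for all $i$. PCI: if $t:P\xrightarrow{\alpha}Q$, $u:P\xrightarrow{\beta}R$, $u':Q\xrightarrow{\beta}S$, $t':R\xrightarrow{\alpha}S$ and $t\,\iota\,u$, then $u'\,\iota\,\overline t$. Pre-reversible means SP, BTI, WF and PCI hold. Events: $\sim$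 is the smallest equivalence relation on transitions such that whenever $t:P\xrightarrow{\alpha}Q$, $u:P\xrightarrow{\beta}R$, $u':Q\xrightarrow{\beta}S$, $t':R\xrightarrow{\alpha}S$ with $t\,\iota\,u$, $\overline u\,\iota\,t'$, $\overline{t'}\,\iota\,\overline{u'}$, $u'\,\iota\,\overline t$, and with $Q\ne R$ if $\alpha,\beta$ are both forward or both reverse labels and $P\ne S$ otherwise, then $t\sim t'$. IRE: whenever $t\sim t'$ and $t'\,\iota\,u$, then $t\,\iota\,u$. -}

module Defs where

open import Data.Nat using (ℕ; suc)
open import Data.Product using (Σ; ∃; _×_; _,_; proj₁)
open import Data.Sum using (_⊎_; inj₁; inj₂)
open import Data.Empty using (⊥)
open import Data.Unit using (⊤)
open import Relation.Nullary using (¬_)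
open import Relation.Binary.PropositionalEquality using (_≡_; _≢_)

-- Labels of all transitions: forward labels (inj₁ a) and reverse labels (inj₂ a = ā).
Lbl : Set → Set
Lbl Lab = Lab ⊎ Lab

rev : {Lab : Set} → Lbl Lab → Lbl Lab
rev (inj₁ a) = inj₂ a
rev (inj₂ a) = inj₁ a

SameDir : {Lab : Set} → Lbl Lab → Lbl Lab → Set
SameDir (inj₁ _) (inj₁ _) = ⊤
SameDir (inj₂ _) (inj₂ _) = ⊤
SameDir (inj₁ _) (inj₂ _) = ⊥
SameDir (inj₂ _) (inj₁ _) = ⊥

Trans : (Proc Lab : Set) → Set
Trans Proc Lab = Proc × Lbl Lab × Proc

Step : {Proc Lab : Set} → (Proc → Lab → Proc → Set) → Trans Proc Lab → Set
Step fwd (P , inj₁ a , Q) = fwd P a Q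
Step fwd (P , inj₂ a , Q) = fwd Q a P

src : {Proc Lab : Set} → Trans Proc Lab → Proc
src (P , _ , _) = P

bar : {Proc Lab : Set} → Trans Proc Lab → Trans Proc Lab
bar (P , α , Q) = (Q , rev α , P)

record LTSI : Set₁ where
  field
    Proc : Set
    Lab  : Set
    fwd  : Proc → Lab → Proc → Set
    ι : Trans Proc Lab → Trans Proc Lab → Set
    ι-trans : ∀ {t u} → ι t u → Step fwd t × Step fwd u
    ι-irrefl : ∀ {t} → ¬ ι t t
    ι-sym : ∀ {t u} → ι t u → ι u t

module _ (L : LTSI) where
  open LTSI L

  Tr : Set
  Tr = Trans Proc Lab

  St : Tr → Set
  St = Step fwd

  SP : Set
  SP = ∀ P α Q β R → ι (P , α , Q) (P , β , R) →
       Σ Proc λ S → St (Q , β , S) × St (R , α , S)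

  BTI : Set
  BTI = ∀ P a Q b R → St (P , inj₂ a , Q) → St (P , inj₂ b , R) →
        _≢_ {A = Tr} (P , inj₂ a , Q) (P , inj₂ b , R) →
        ι (P , inj₂ a , Q) (P , inj₂ b , R)

  WF : Set
  WF = ¬ (Σ (ℕ → Proc) λ p → Σ (ℕ → Lab) λ a → ∀ i → fwd (p (suc i)) (a i) (p i))

  PCI : Set
  PCI = ∀ P α Q β R S →
        St (P , α , Q) → St (P , β , R) → St (Q , β , S) → St (R , α , S) →
        ι (P , α , Q) (P , β , R) →
        ι (Q , β , S) (bar (P , α , Q))

  PreReversible : Set
  PreReversible = SP × BTI × WF × PCI

  Distinct : Lbl Lab → Lbl Lab → Proc → Proc → Proc → Proc → Set
  Distinct α β P Q R S = (SameDir α β → Q ≢ R) × (¬ SameDir α β → P ≢ S)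

  data _∼_ : Tr → Tr → Set where
    ∼-gen : ∀ {P α Q β R S} →
      St (P , α , Q) → St (P , β , R) → St (Q , β , S) → St (R , α , S) →
      ι (P , α , Q) (P , β , R) →
      ι (bar (P , β , R)) (R , α , S) →
      ι (bar (R , α , S)) (bar (Q , β , S)) →
      ι (Q , β , S) (bar (P , α , Q)) →
      Distinct α β P Q R S →
      (P , α , Q) ∼ (R , α , S)
    ∼-refl : ∀ {t} → t ∼ t
    ∼-sym : ∀ {t u} → t ∼ u → u ∼ t
    ∼-trans : ∀ {t u v} → t ∼ u → u ∼ v → t ∼ v

  IRE : Set
  IRE = ∀ t t' u → t ∼ t' → ι t' u → ι t u

  IC : Set
  IC = ∀ t u → ι t u → src t ≡ src u

  ι-NonEmpty : Set
  ι-NonEmpty = Σ Tr λ t → Σ Tr λ u → ι t u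

-- Under IC, independent transitions t : P →α Q and u : P →β R are coinitial, and SP
-- with PCI closes them into a square P →α Q →β S, P →β R →α S whose four sides are
-- pairwise independent as required by the definition of ∼; so t ∼ t' for the side
-- t' : R →α S, which is independent of ū : R →β̄ P. IRE would make t independent of ū,
-- and IC would then force P = R, i.e. u would be a loop, contradicting WF.  The
-- non-degeneracy side condition of ∼ holds because two distinct forward transitions
-- with the same endpoints generate, via BTI and SP, an infinite backward chain.
module Submission where

open import Defs
open import Relation.Nullary using (¬_)
open import Data.Nat using (ℕ)
open import Data.Nat.GeneralisedArithmetic using (fold)
open import Data.Product using (Σ; _×_; _,_; proj₁; proj₂)
open import Data.Sum using (inj₁; inj₂)
open import Data.Unit using (tt)
open import Relation.Binary.PropositionalEquality using (_≢_; refl; cong)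

module _ (L : LTSI) where
  open LTSI L

  Step-bar : ∀ t → St L t → St L (bar t)
  Step-bar (P , inj₁ a , Q) s = s
  Step-bar (P , inj₂ a , Q) s = s

  WF⇒¬loop : WF L → ∀ {P} β → ¬ St L (P , β , P)
  WF⇒¬loop wf {P} (inj₁ b) s = wf ((λ _ → P) , (λ _ → b) , λ _ → s)
  WF⇒¬loop wf {P} (inj₂ b) s = wf ((λ _ → P) , (λ _ → b) , λ _ → s)

  ι-parallel⇒labels-differ : ∀ {P α β Q} → ι (P , α , Q) (P , β , Q) → α ≢ β
  ι-parallel⇒labels-differ i refl = ι-irrefl i

  ParallelPair : Lab → Lab → Set
  ParallelPair a b = Σ Proc λ P → Σ Proc λ Q → fwd P a Q × fwd P b Q

  module _ (sp : SP L) (bti : BTI L) where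

    -- Reversing the pair from Q gives two independent backward transitions (BTI),
    -- which SP completes to a parallel pair ending in P.
    ParallelPair-extend : ∀ {a b} → a ≢ b → ParallelPair a b → ParallelPair a b
    ParallelPair-extend {a} {b} a≢b (P , Q , x , y) =
      let (S , Sb , Sa) = sp Q (inj₂ a) P (inj₂ b) P
                             (bti Q a P b P x y λ { refl → a≢b refl })
      in S , P , Sa , Sb

    ¬distinct-parallel-fwd : WF L → ∀ {a b P Q} → a ≢ b → ¬ (fwd P a Q × fwd P b Q)
    ¬distinct-parallel-fwd wf {a} {b} {P} {Q} a≢b (x , y) =
      wf ((λ i → proj₁ (proj₂ (chain i))) , (λ _ → a) , λ i → proj₁ (proj₂ (proj₂ (chain i))))
      where
      chain : ℕ → ParallelPair a b
      chain = fold (P , Q , x , y) (ParallelPair-extend a≢b)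

    square-distinct : WF L → ∀ {P Q R S} α β →
      St L (P , α , Q) → St L (P , β , R) → St L (Q , β , S) → St L (R , α , S) →
      ι (P , α , Q) (P , β , R) → ι (Q , β , S) (bar (P , α , Q)) →
      Distinct L α β P Q R S
    square-distinct wf (inj₁ a) (inj₁ b) t u _ _ tu _ =
      (λ _ → λ { refl → ¬distinct-parallel-fwd wf (λ e → ι-parallel⇒labels-differ tu (cong inj₁ e)) (t , u) })
      , λ notSame _ → notSame tt
    square-distinct wf (inj₂ a) (inj₂ b) t u _ _ tu _ =
      (λ _ → λ { refl → ¬distinct-parallel-fwd wf (λ e → ι-parallel⇒labels-differ tu (cong inj₂ e)) (t , u) })
      , λ notSame _ → notSame tt
    square-distinct wf (inj₁ a) (inj₂ b) t _ u' _ _ u'ιt̄ =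
      (λ ())
      , λ _ → λ { refl → ¬distinct-parallel-fwd wf (λ e → ι-parallel⇒labels-differ u'ιt̄ (cong inj₂ e)) (u' , t) }
    square-distinct wf (inj₂ a) (inj₁ b) t _ u' _ _ u'ιt̄ =
      (λ ())
      , λ _ → λ { refl → ¬distinct-parallel-fwd wf (λ e → ι-parallel⇒labels-differ u'ιt̄ (cong inj₁ e)) (u' , t) }

  ι⇒∼-across-square : PreReversible L → ∀ {P α Q β R} → ι (P , α , Q) (P , β , R) →
    Σ Proc λ S → _∼_ L (P , α , Q) (R , α , S) × ι (R , α , S) (bar (P , β , R))
  ι⇒∼-across-square (sp , bti , wf , pci) {P} {α} {Q} {β} {R} tιu =
    S , ∼-gen t u u' t' tιu (ι-sym t'ιū) t̄'ιū' u'ιt̄ (square-distinct sp bti wf α β t u u' t' tιu u'ιt̄)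
      , t'ιū
    where
    t : St L (P , α , Q)
    t = proj₁ (ι-trans tιu)
    u : St L (P , β , R)
    u = proj₂ (ι-trans tιu)
    S : Proc
    S = proj₁ (sp P α Q β R tιu)
    u' : St L (Q , β , S)
    u' = proj₁ (proj₂ (sp P α Q β R tιu))
    t' : St L (R , α , S)
    t' = proj₂ (proj₂ (sp P α Q β R tιu))
    u'ιt̄ : ι (Q , β , S) (bar (P , α , Q))
    u'ιt̄ = pci P α Q β R S t u u' t' tιu
    t'ιū : ι (R , α , S) (bar (P , β , R))
    t'ιū = pci P β R α Q S u t t' u' (ι-sym tιu)
    t̄'ιū' : ι (bar (R , α , S)) (bar (Q , β , S))
    t̄'ιū' = pci Q β S (rev α) P R u' (Step-bar (P , α , Q) t) (Step-bar (R , α , S) t') u u'ιt̄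

proposition6p3 : (L : LTSI) → PreReversible L → ι-NonEmpty L → IC L → ¬ IRE L
proposition6p3 L pr@(_ , _ , wf , _) (_ , (_ , β , _) , tιu) ic ire with ic _ _ tιu
... | refl with ι⇒∼-across-square L pr tιu
... | _ , t∼t' , t'ιū with ic _ _ (ire _ _ _ t∼t' t'ιū)
... | refl = WF⇒¬loop L wf β (proj₂ (LTSI.ι-trans L tιu))
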